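{- Fix $1\le p\le n$, a $p$-element subset $Y\subseteq[n]$ and $w\in\mathfrak S_n$ with $Y\le\{w_1,\dots,w_p\}$. Define $\sigma_1,\dots,\sigma_p$ recursively by letting $\sigma_j$ be the maximum element of $Y\setminus\{\sigma_1,\dots,\sigma_{j-1}\}$ not exceeding $w_j$. Let $1\le i\le p$ and $y\in Y\setminus\{\sigma_1,\dots,\sigma_{i-1}\}$. Then: (1) $\sigma_i\le w_i$; (2) $\sigma_i<y$ if and only if $w_i<y$; (3) $|W^i[y-1]|=|\Sigma^i[y-1]|$, where $W^i=\{w_1,\dots,w_i\}$, $\Sigma^i=\{\sigma_1,\dots,\sigma_i\}$, and $E[z]:=\{e\in E:e\le z\}$.
   Context: For $t$-element subsets $E,F\subseteq[n]$, $E\le F$ means the $k$-th smallest element of $E$ is at most the $k$-th smallest element of $F$ for every $k$. (Under the hypothesis, the elements $\sigma_j$ are well defined.) -}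

module Defs where

open import Data.Nat using (ℕ)
open import Data.Fin using (Fin) renaming (_≤_ to _≤ᶠ_; _<_ to _<ᶠ_)
open import Data.Fin.Properties using (_≤?_; _<?_)
open import Data.Fin.Subset using (Subset; ⁅_⁆; _∪_; _-_; ⊥)
open import Data.Fin.Subset.Properties using (_∈?_)
open import Data.Fin.Permutation using (Permutation′; _⟨$⟩ʳ_)
open import Data.List using (List; []; _∷_; filter; last; allFin; map; foldr)
open import Data.List.Relation.Binary.Pointwise using (Pointwise)
open import Data.Maybe using (Maybe; just; nothing)
import Data.Maybe as Maybe
open import Data.Vec using (tabulate)
open import Data.Product using (_×_)
open import Relation.Nullary using (does)
open import Relation.Nullary.Decidable using (_×-dec_)

-- [n] is modelled as Fin n = {0,…,n-1} (order-preserving shift by one).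

elems : ∀ {n} → Subset n → List (Fin n)
elems S = filter (_∈? S) (allFin _)

-- E ≤ F : k-th smallest element of E is ≤ k-th smallest element of F, for all k
-- (used for subsets of equal size t)
_≤ˢ_ : ∀ {n} → Subset n → Subset n → Set
E ≤ˢ F = Pointwise _≤ᶠ_ (elems E) (elems F)

fromList : ∀ {n} → List (Fin n) → Subset n
fromList = foldr (λ x S → ⁅ x ⁆ ∪ S) ⊥

-- the one-line notation w₁ w₂ … wₙ of a permutation (w_j = w ⟨$⟩ʳ (j-1))
oneLine : ∀ {n} → Permutation′ n → List (Fin n)
oneLine w = map (w ⟨$⟩ʳ_) (allFin _)

maxBelow : ∀ {n} → Subset n → Fin n → Maybe (Fin n)
maxBelow S t = last (filter (λ x → (x ∈? S) ×-dec (x ≤? t)) (allFin _))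

sigmaSeq : ∀ {n} → Subset n → List (Fin n) → Maybe (List (Fin n))
sigmaSeq R [] = just []
sigmaSeq R (t ∷ ts) with maxBelow R t
... | nothing = nothing
... | just s  = Maybe.map (s ∷_) (sigmaSeq (R - s) ts)

-- the subset {e : e < y} = {e : e ≤ y-1}
lessThan : ∀ {n} → Fin n → Subset n
lessThan y = tabulate (λ x → does (x <? y))

-- Comparing the sorted lists entrywise, Y ≤ {w₁,…,w_p} implies that for every z at most
-- |Y ∩ [0,z]| of the targets w₁,…,w_p are ≤ z: Hall's condition for matching every target to a
-- distinct element of Y below it. Under it the greedy choice σⱼ exists, and removing σⱼ leaves
-- Hall's condition for the remaining set and targets, so by induction all σⱼ are defined and
-- σⱼ ≤ wⱼ. As σⱼ is the largest remaining element not exceeding wⱼ, no element still available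
-- lies in (σⱼ, wⱼ]; hence σⱼ < y ⇔ wⱼ < y for every y still available at step j. A y ∈ Y that is
-- none of σ₁,…,σᵢ₋₁ is available at every step j ≤ i, which gives (2) at j = i and, summed over
-- j ≤ i, the equality of counts (3).
module Submission where

open import Data.Fin using (Fin; toℕ) renaming (_≤_ to _≤ᶠ_; _<_ to _<ᶠ_)
open import Data.Fin.Permutation using (Permutation′; _⟨$⟩ʳ_)
open import Data.Fin.Properties using (_≤?_; _<?_; <⇒≢)
open import Data.Fin.Subset
  using (Subset; inside; outside; _∈_; _∉_; _⊆_; _∩_; _∪_; _-_; ∣_∣; ⁅_⁆; Nonempty)
open import Data.Fin.Subset.Properties
  using (_∈?_; ∉⊥; p─⊥≡p; ∪-identityˡ; ∩-zeroˡ; ⊆-refl; ⊆-antisym; x∈p∩q⁺; x∈p∩q⁻; x∈p∪q⁻; x∈⁅x⁆;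
         x∈⁅y⁆⇒x≡y; p⊆p∪q; q⊆p∪q; p─q⊆p; x∈p∧x≢y⇒x∈p-y; p⊆q⇒∣p∣≤∣q∣; nonempty?; Empty-unique;
         ∣⊥∣≡0)
import Data.List as List
open import Data.List using (List; []; _∷_; _++_; [_]; length; filter; take; last; allFin)
open import Data.List.Properties
  using (filter-accept; filter-reject; filter-none; filter-++; length-++; map-tabulate; take-suc-tabulate)
open import Data.List.Membership.Propositional using () renaming (_∈_ to _∈ˡ_; _∉_ to _∉ˡ_)
open import Data.List.Membership.Propositional.Properties using (∈-filter⁺; ∈-filter⁻; ∈-allFin)
open import Data.List.Relation.Binary.Pointwise using (Pointwise; []; _∷_)
open import Data.List.Relation.Binary.Sublist.Propositional using () renaming (_⊆_ to _⊑_; ⊆-refl to ⊑-refl)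
import Data.List.Relation.Binary.Sublist.Propositional.Properties as Sublist
open import Data.List.Relation.Unary.All as All using (All; []; _∷_)
open import Data.List.Relation.Unary.AllPairs as AllPairs using (AllPairs; []; _∷_)
import Data.List.Relation.Unary.AllPairs.Properties as AllPairsₚ
import Data.List.Relation.Unary.Any as Any
open import Data.List.Relation.Unary.Unique.Propositional using (Unique)
import Data.List.Relation.Unary.Unique.Propositional.Properties as Uniqueₚ
open import Data.Maybe using (just)
import Data.Maybe as Maybe
open import Data.Nat using (ℕ; _≤_; _<_; suc; _+_; z≤n; s≤s; s≤s⁻¹)
import Data.Nat.Properties as ℕ
open import Data.Product using (_×_; ∃; ∃₂; _,_; proj₂)
open import Data.Sum using (inj₁; inj₂)
open import Data.Vec using (tabulate; _∷_; here; there)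
open import Data.Vec.Properties using ([]=⇒lookup; lookup⇒[]=; lookup∘tabulate)
open import Defs
open import Function using (_∘_; id)
open import Function.Bundles using (Injection)
open import Function.Properties.Inverse using (↔⇒↣)
open import Relation.Binary.PropositionalEquality
  using (_≡_; refl; sym; trans; cong; cong₂; subst; module ≡-Reasoning)
open import Relation.Nullary using (Dec; does; yes; no; contradiction)
open import Relation.Nullary.Decidable using (dec-true; _×-dec_)
open import Relation.Unary using (Pred; Decidable)

private
  variable
    n : ℕ
    x y s t : Fin n
    p q r R R′ : Subset n
    xs ys ts σs : List (Fin n)

module _ {ℓ} {P : Pred (Fin n) ℓ} (P? : Decidable P) where

  ∈-tabulate⁺ : P x → x ∈ tabulate (λ z → does (P? z))
  ∈-tabulate⁺ {x} px = lookup⇒[]= x _ (trans (lookup∘tabulate _ x) (dec-true (P? x) px))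

  ∈-tabulate⁻ : x ∈ tabulate (λ z → does (P? z)) → P x
  ∈-tabulate⁻ {x} x∈ with P? x | trans (sym (lookup∘tabulate _ x)) ([]=⇒lookup x∈)
  ... | yes px | _ = px

∣p∩q∣≡1+∣p-x∩q∣ : x ∈ p → x ∈ q → ∣ p ∩ q ∣ ≡ suc ∣ (p - x) ∩ q ∣
∣p∩q∣≡1+∣p-x∩q∣ {p = inside  ∷ p} {q = inside  ∷ q} here here = cong (λ p′ → suc ∣ p′ ∩ q ∣) (sym (p─⊥≡p p))
∣p∩q∣≡1+∣p-x∩q∣ {p = inside  ∷ p} {q = inside  ∷ q} (there x∈p) (there x∈q) = cong suc (∣p∩q∣≡1+∣p-x∩q∣ x∈p x∈q)
∣p∩q∣≡1+∣p-x∩q∣ {p = inside  ∷ p} {q = outside ∷ q} (there x∈p) (there x∈q) = ∣p∩q∣≡1+∣p-x∩q∣ x∈p x∈q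
∣p∩q∣≡1+∣p-x∩q∣ {p = outside ∷ p} {q = _       ∷ q} (there x∈p) (there x∈q) = ∣p∩q∣≡1+∣p-x∩q∣ x∈p x∈q

x∉q⇒p-x∩q≡p∩q : x ∉ q → (p - x) ∩ q ≡ p ∩ q
x∉q⇒p-x∩q≡p∩q {x = Fin.zero}  {q = inside  ∷ q} x∉q = contradiction here x∉q
x∉q⇒p-x∩q≡p∩q {x = Fin.zero}  {q = outside ∷ q} {p = inside  ∷ p} _ = cong (λ p′ → outside ∷ p′ ∩ q) (p─⊥≡p p)
x∉q⇒p-x∩q≡p∩q {x = Fin.zero}  {q = outside ∷ q} {p = outside ∷ p} _ = cong (λ p′ → outside ∷ p′ ∩ q) (p─⊥≡p p)
x∉q⇒p-x∩q≡p∩q {x = Fin.suc x} {q = _ ∷ q} {p = _ ∷ p} x∉q = cong (_ ∷_) (x∉q⇒p-x∩q≡p∩q (x∉q ∘ there))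

x∉p⇒⁅x⁆∪p-x≡p : x ∉ p → (⁅ x ⁆ ∪ p) - x ≡ p
x∉p⇒⁅x⁆∪p-x≡p {x = Fin.zero}  {p = inside  ∷ p} x∉p = contradiction here x∉p
x∉p⇒⁅x⁆∪p-x≡p {x = Fin.zero}  {p = outside ∷ p} _ = cong (outside ∷_) (trans (p─⊥≡p _) (∪-identityˡ p))
x∉p⇒⁅x⁆∪p-x≡p {x = Fin.suc x} {p = a ∷ p} x∉p = cong (a ∷_) (x∉p⇒⁅x⁆∪p-x≡p (x∉p ∘ there))

x∉p-x : x ∉ p - x
x∉p-x {x = Fin.suc x} {p = _ ∷ p} (there x∈p-x) = x∉p-x x∈p-x

0<∣p∣⇒Nonempty : ∀ {n} {p : Subset n} → 0 < ∣ p ∣ → Nonempty p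
0<∣p∣⇒Nonempty {n} {p} 0<∣p∣ with nonempty? p
... | yes nonempty = nonempty
... | no  empty    = contradiction (trans (cong ∣_∣ (Empty-unique empty)) (∣⊥∣≡0 n)) (ℕ.n>0⇒n≢0 0<∣p∣)

∈-fromList⁺ : x ∈ˡ xs → x ∈ fromList xs
∈-fromList⁺ {xs = y ∷ xs} (Any.here refl) = p⊆p∪q (fromList xs) (x∈⁅x⁆ y)
∈-fromList⁺ {xs = y ∷ xs} (Any.there x∈xs) = q⊆p∪q ⁅ y ⁆ (fromList xs) (∈-fromList⁺ x∈xs)

∈-fromList⁻ : x ∈ fromList xs → x ∈ˡ xs
∈-fromList⁻ {xs = []}     x∈⊥ = contradiction x∈⊥ ∉⊥
∈-fromList⁻ {xs = y ∷ xs} x∈ with x∈p∪q⁻ ⁅ y ⁆ (fromList xs) x∈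
... | inj₁ x∈⁅y⁆ = Any.here (x∈⁅y⁆⇒x≡y y x∈⁅y⁆)
... | inj₂ x∈xs  = Any.there (∈-fromList⁻ x∈xs)

countIn : Subset n → List (Fin n) → ℕ
countIn q xs = length (filter (_∈? q) xs)

countIn-∷-∈ : x ∈ q → countIn q (x ∷ xs) ≡ suc (countIn q xs)
countIn-∷-∈ {q = q} x∈q = cong length (filter-accept (_∈? q) x∈q)

countIn-∷-∉ : x ∉ q → countIn q (x ∷ xs) ≡ countIn q xs
countIn-∷-∉ {q = q} x∉q = cong length (filter-reject (_∈? q) x∉q)

countIn-∷-cong : (x ∈ q → y ∈ q) → (y ∈ q → x ∈ q) → countIn q xs ≡ countIn q ys →
                 countIn q (x ∷ xs) ≡ countIn q (y ∷ ys)
countIn-∷-cong {x = x} {q = q} {y = y} {xs = xs} {ys = ys} x⇒y y⇒x eq = by-cases (x ∈? q)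
  where
  by-cases : Dec (x ∈ q) → countIn q (x ∷ xs) ≡ countIn q (y ∷ ys)
  by-cases (yes x∈q) = trans (countIn-∷-∈ x∈q) (trans (cong suc eq) (sym (countIn-∷-∈ (x⇒y x∈q))))
  by-cases (no  x∉q) = trans (countIn-∷-∉ x∉q) (trans eq (sym (countIn-∷-∉ (x∉q ∘ y⇒x))))

countIn-++ : ∀ xs ys → countIn q (xs ++ ys) ≡ countIn q xs + countIn q ys
countIn-++ {q = q} xs ys = trans (cong length (filter-++ (_∈? q) xs ys)) (length-++ (filter (_∈? q) xs))

countIn-none : All (_∉ q) xs → countIn q xs ≡ 0
countIn-none {q = q} none = cong length (filter-none (_∈? q) none)

countIn-mono : q ⊆ r → xs ⊑ ys → countIn q xs ≤ countIn r ys
countIn-mono {q = q} {r = r} q⊆r xs⊑ys =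
  Sublist.length-mono-≤ (Sublist.filter⁺ (_∈? q) (_∈? r) (λ { refl → q⊆r }) xs⊑ys)

∣fromList∩q∣≡countIn : ∀ {n} {xs : List (Fin n)} {q} → Unique xs → ∣ fromList xs ∩ q ∣ ≡ countIn q xs
∣fromList∩q∣≡countIn {n} {xs = []} {q = q} _ = trans (cong ∣_∣ (∩-zeroˡ q)) (∣⊥∣≡0 n)
∣fromList∩q∣≡countIn {xs = x ∷ xs} {q = q} (x∉xs ∷ unique) = by-cases (x ∈? q)
  where
  open ≡-Reasoning
  x∉fromList : x ∉ fromList xs
  x∉fromList x∈ = All.lookup x∉xs (∈-fromList⁻ x∈) refl
  remove-x : (⁅ x ⁆ ∪ fromList xs) - x ≡ fromList xs
  remove-x = x∉p⇒⁅x⁆∪p-x≡p x∉fromList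
  x∈⁅x⁆∪xs : x ∈ ⁅ x ⁆ ∪ fromList xs
  x∈⁅x⁆∪xs = p⊆p∪q (fromList xs) (x∈⁅x⁆ x)
  by-cases : Dec (x ∈ q) → ∣ fromList (x ∷ xs) ∩ q ∣ ≡ countIn q (x ∷ xs)
  by-cases (yes x∈q) = begin
    ∣ (⁅ x ⁆ ∪ fromList xs) ∩ q ∣          ≡⟨ ∣p∩q∣≡1+∣p-x∩q∣ x∈⁅x⁆∪xs x∈q ⟩
    suc ∣ ((⁅ x ⁆ ∪ fromList xs) - x) ∩ q ∣ ≡⟨ cong (λ p′ → suc ∣ p′ ∩ q ∣) remove-x ⟩
    suc ∣ fromList xs ∩ q ∣                ≡⟨ cong suc (∣fromList∩q∣≡countIn unique) ⟩
    suc (countIn q xs)                     ≡⟨ countIn-∷-∈ x∈q ⟨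
    countIn q (x ∷ xs)                     ∎
  by-cases (no x∉q) = begin
    ∣ (⁅ x ⁆ ∪ fromList xs) ∩ q ∣          ≡⟨ cong ∣_∣ (x∉q⇒p-x∩q≡p∩q {p = ⁅ x ⁆ ∪ fromList xs} x∉q) ⟨
    ∣ ((⁅ x ⁆ ∪ fromList xs) - x) ∩ q ∣     ≡⟨ cong (λ p′ → ∣ p′ ∩ q ∣) remove-x ⟩
    ∣ fromList xs ∩ q ∣                    ≡⟨ ∣fromList∩q∣≡countIn unique ⟩
    countIn q xs                           ≡⟨ countIn-∷-∉ x∉q ⟨
    countIn q (x ∷ xs)                     ∎

allFin-sorted : AllPairs _<ᶠ_ (allFin n)
allFin-sorted = AllPairsₚ.tabulate⁺-< id

elems-sorted : ∀ (S : Subset n) → AllPairs _<ᶠ_ (elems S)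
elems-sorted S = AllPairsₚ.filter⁺ (_∈? S) allFin-sorted

fromList-elems : ∀ (S : Subset n) → fromList (elems S) ≡ S
fromList-elems S = ⊆-antisym
  (λ x∈ → proj₂ (∈-filter⁻ (_∈? S) {xs = allFin _} (∈-fromList⁻ x∈)))
  (λ x∈S → ∈-fromList⁺ (∈-filter⁺ (_∈? S) (∈-allFin _) x∈S))

countIn-elems : ∀ (S : Subset n) → countIn q (elems S) ≡ ∣ S ∩ q ∣
countIn-elems {q = q} S = begin
  countIn q (elems S)          ≡⟨ ∣fromList∩q∣≡countIn (AllPairs.map <⇒≢ (elems-sorted S)) ⟨
  ∣ fromList (elems S) ∩ q ∣   ≡⟨ cong (λ S′ → ∣ S′ ∩ q ∣) (fromList-elems S) ⟩
  ∣ S ∩ q ∣                    ∎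
  where open ≡-Reasoning

DownClosed : Subset n → Set
DownClosed q = ∀ {x y} → x ≤ᶠ y → y ∈ q → x ∈ q

countIn-pointwise-≤ : DownClosed q → Pointwise _≤ᶠ_ xs ys → AllPairs _<ᶠ_ ys →
                      countIn q ys ≤ countIn q xs
countIn-pointwise-≤ closed [] [] = z≤n
countIn-pointwise-≤ {q = q} {xs = x ∷ xs} {ys = y ∷ ys} closed (x≤y ∷ xs≤ys) (y<ys ∷ sorted) = by-cases (y ∈? q)
  where
  by-cases : Dec (y ∈ q) → countIn q (y ∷ ys) ≤ countIn q (x ∷ xs)
  by-cases (yes y∈q) rewrite countIn-∷-∈ {xs = ys} y∈q | countIn-∷-∈ {xs = xs} (closed x≤y y∈q) =
    s≤s (countIn-pointwise-≤ closed xs≤ys sorted)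
  by-cases (no y∉q) rewrite countIn-none (y∉q ∷ All.map (λ y<z z∈q → y∉q (closed (ℕ.<⇒≤ y<z) z∈q)) y<ys) =
    z≤n

atMost : Fin n → Subset n
atMost z = tabulate (λ x → does (x ≤? z))

atMost-downClosed : ∀ (z : Fin n) → DownClosed (atMost z)
atMost-downClosed z x≤y y∈ = ∈-tabulate⁺ (_≤? z) (ℕ.≤-trans x≤y (∈-tabulate⁻ (_≤? z) y∈))

atMost-mono : x ≤ᶠ y → atMost x ⊆ atMost y
atMost-mono {x = x} {y = y} x≤y v∈ = ∈-tabulate⁺ (_≤? y) (ℕ.≤-trans (∈-tabulate⁻ (_≤? x) v∈) x≤y)

t∈atMost[t] : ∀ (t : Fin n) → t ∈ atMost t
t∈atMost[t] t = ∈-tabulate⁺ (_≤? t) ℕ.≤-refl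

Hall : Subset n → List (Fin n) → Set
Hall R ts = ∀ z → countIn (atMost z) ts ≤ ∣ R ∩ atMost z ∣

hall-⊑ : xs ⊑ ys → Hall R ys → Hall R xs
hall-⊑ xs⊑ys hall z = ℕ.≤-trans (countIn-mono ⊆-refl xs⊑ys) (hall z)

gale⇒hall : Unique ts → R ≤ˢ fromList ts → Hall R ts
gale⇒hall {ts = ts} {R = R} unique R≤ts z = begin
  countIn (atMost z) ts                     ≡⟨ ∣fromList∩q∣≡countIn unique ⟨
  ∣ fromList ts ∩ atMost z ∣                ≡⟨ countIn-elems (fromList ts) ⟨
  countIn (atMost z) (elems (fromList ts))  ≤⟨ countIn-pointwise-≤ (atMost-downClosed z) R≤ts (elems-sorted _) ⟩
  countIn (atMost z) (elems R)              ≡⟨ countIn-elems R ⟩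
  ∣ R ∩ atMost z ∣                          ∎
  where open ℕ.≤-Reasoning

last-sorted : AllPairs _<ᶠ_ xs → x ∈ˡ xs → ∃ λ s → last xs ≡ just s × s ∈ˡ xs × All (_≤ᶠ s) xs
last-sorted {xs = y ∷ []} _ _ = y , refl , Any.here refl , ℕ.≤-refl ∷ []
last-sorted {xs = y ∷ y′ ∷ ys} (y<ys ∷ sorted) _ =
  let s , last≡s , s∈ , ≤s = last-sorted sorted (Any.here refl)
  in  s , last≡s , Any.there s∈ , ℕ.<⇒≤ (ℕ.<-≤-trans (All.head y<ys) (All.head ≤s)) ∷ ≤s

MaxBelow : Subset n → Fin n → Fin n → Set
MaxBelow R t s = s ∈ R × s ≤ᶠ t × (∀ {v} → v ∈ R → v ≤ᶠ t → v ≤ᶠ s)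

maxBelow-spec : x ∈ R → x ≤ᶠ t → ∃ λ s → maxBelow R t ≡ just s × MaxBelow R t s
maxBelow-spec {R = R} {t = t} x∈R x≤t =
  let s , last≡s , s∈ , ≤s = last-sorted (AllPairsₚ.filter⁺ below? allFin-sorted)
                                         (∈-filter⁺ below? (∈-allFin _) (x∈R , x≤t))
      _ , s∈R , s≤t = ∈-filter⁻ below? {xs = allFin _} s∈
  in  s , last≡s , s∈R , s≤t , λ v∈R v≤t → All.lookup ≤s (∈-filter⁺ below? (∈-allFin _) (v∈R , v≤t))
  where
  below? : Decidable (λ v → v ∈ R × v ≤ᶠ t)
  below? v = (v ∈? R) ×-dec (v ≤? t)

hall⇒maxBelow : Hall R (t ∷ ts) → ∃ λ s → maxBelow R t ≡ just s × MaxBelow R t s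
hall⇒maxBelow {R = R} {t = t} hall =
  let size>0 = ℕ.≤-trans (s≤s z≤n) (subst (_≤ ∣ R ∩ atMost t ∣) (countIn-∷-∈ (t∈atMost[t] t)) (hall t))
      v , v∈ = 0<∣p∣⇒Nonempty size>0
      v∈R , v∈atMost = x∈p∩q⁻ R (atMost t) v∈
  in  maxBelow-spec v∈R (∈-tabulate⁻ (_≤? t) v∈atMost)

hall-remove : Hall R (t ∷ ts) → MaxBelow R t s → Hall (R - s) ts
hall-remove {R = R} {t = t} {ts = ts} {s = s} hall (s∈R , s≤t , max) z = by-cases (t ≤? z) (s ≤? z)
  where
  open ℕ.≤-Reasoning
  A = atMost z
  remove-s : s ≤ᶠ z → ∣ R ∩ A ∣ ≡ suc ∣ (R - s) ∩ A ∣
  remove-s s≤z = ∣p∩q∣≡1+∣p-x∩q∣ s∈R (∈-tabulate⁺ (_≤? z) s≤z)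
  -- R has no element in (s, t]
  R∩atMost[t]⊆R∩A : s ≤ᶠ z → R ∩ atMost t ⊆ R ∩ A
  R∩atMost[t]⊆R∩A s≤z v∈ =
    let v∈R , v≤t = x∈p∩q⁻ R (atMost t) v∈
    in  x∈p∩q⁺ (v∈R , ∈-tabulate⁺ (_≤? z) (ℕ.≤-trans (max v∈R (∈-tabulate⁻ (_≤? t) v≤t)) s≤z))
  by-cases : Dec (t ≤ᶠ z) → Dec (s ≤ᶠ z) → countIn A ts ≤ ∣ (R - s) ∩ A ∣
  by-cases (yes t≤z) _ = s≤s⁻¹ (begin
    suc (countIn A ts)    ≡⟨ countIn-∷-∈ (∈-tabulate⁺ (_≤? z) t≤z) ⟨
    countIn A (t ∷ ts)    ≤⟨ hall z ⟩
    ∣ R ∩ A ∣             ≡⟨ remove-s (ℕ.≤-trans s≤t t≤z) ⟩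
    suc ∣ (R - s) ∩ A ∣   ∎)
  by-cases (no t≰z) (no s≰z) = begin
    countIn A ts          ≡⟨ countIn-∷-∉ {xs = ts} (t≰z ∘ ∈-tabulate⁻ (_≤? z)) ⟨
    countIn A (t ∷ ts)    ≤⟨ hall z ⟩
    ∣ R ∩ A ∣             ≡⟨ cong ∣_∣ (x∉q⇒p-x∩q≡p∩q {p = R} (s≰z ∘ ∈-tabulate⁻ (_≤? z))) ⟨
    ∣ (R - s) ∩ A ∣       ∎
  by-cases (no t≰z) (yes s≤z) = s≤s⁻¹ (begin
    suc (countIn A ts)            ≤⟨ s≤s (countIn-mono {xs = ts} (atMost-mono (ℕ.<⇒≤ (ℕ.≰⇒> t≰z))) ⊑-refl) ⟩
    suc (countIn (atMost t) ts)   ≡⟨ countIn-∷-∈ (t∈atMost[t] t) ⟨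
    countIn (atMost t) (t ∷ ts)   ≤⟨ hall t ⟩
    ∣ R ∩ atMost t ∣              ≤⟨ p⊆q⇒∣p∣≤∣q∣ {p = R ∩ atMost t} (R∩atMost[t]⊆R∩A s≤z) ⟩
    ∣ R ∩ A ∣                     ≡⟨ remove-s s≤z ⟩
    suc ∣ (R - s) ∩ A ∣           ∎)

maxBelow-<-iff : MaxBelow R t s → y ∈ R → (s <ᶠ y → t <ᶠ y) × (t <ᶠ y → s <ᶠ y)
maxBelow-<-iff (_ , s≤t , max) y∈R =
  (λ s<y → ℕ.≰⇒> (λ y≤t → ℕ.<⇒≱ s<y (max y∈R y≤t))) , ℕ.≤-<-trans s≤t

data Greedy : Subset n → List (Fin n) → List (Fin n) → Subset n → Set where
  []  : Greedy R [] [] R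
  _∷_ : MaxBelow R t s → Greedy (R - s) ts σs R′ → Greedy R (t ∷ ts) (s ∷ σs) R′

sigmaSeq-∷ : maxBelow R t ≡ just s → sigmaSeq R (t ∷ ts) ≡ Maybe.map (s ∷_) (sigmaSeq (R - s) ts)
sigmaSeq-∷ maxBelow≡s rewrite maxBelow≡s = refl

hall⇒greedy : Hall R ts → ∃₂ λ σs R′ → sigmaSeq R ts ≡ just σs × Greedy R ts σs R′
hall⇒greedy {ts = []} _ = [] , _ , refl , []
hall⇒greedy {ts = t ∷ ts} hall with hall⇒maxBelow hall
... | s , maxBelow≡s , max with hall⇒greedy (hall-remove hall max)
... | σs , R′ , sigmaSeq≡σs , run =
  s ∷ σs , R′ , trans (sigmaSeq-∷ maxBelow≡s) (cong (Maybe.map (s ∷_)) sigmaSeq≡σs) , max ∷ run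

greedy-∷ʳ⁻ : ∀ {σ R″} → Greedy R (ts ++ [ t ]) σ R″ →
             ∃₂ λ σs s → ∃ λ R′ → σ ≡ σs ++ [ s ] × Greedy R ts σs R′ × MaxBelow R′ t s
greedy-∷ʳ⁻ {ts = []} (max ∷ []) = [] , _ , _ , refl , [] , max
greedy-∷ʳ⁻ {ts = _ ∷ ts} (max ∷ run) with greedy-∷ʳ⁻ run
... | σs , s , R′ , refl , run′ , max′ = _ ∷ σs , s , R′ , refl , max ∷ run′ , max′

greedy-⊆ : Greedy R ts σs R′ → All (_∈ R) σs
greedy-⊆ [] = []
greedy-⊆ ((s∈R , _) ∷ run) = s∈R ∷ All.map (p─q⊆p _ _) (greedy-⊆ run)

greedy-unique : Greedy R ts σs R′ → Unique σs
greedy-unique [] = []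
greedy-unique (_ ∷ run) =
  All.map (λ v∈R-s s≡v → x∉p-x (subst (_∈ _) (sym s≡v) v∈R-s)) (greedy-⊆ run) ∷ greedy-unique run

greedy-remaining : Greedy R ts σs R′ → y ∈ R → y ∉ˡ σs → y ∈ R′
greedy-remaining [] y∈R _ = y∈R
greedy-remaining (_ ∷ run) y∈R y∉σs =
  greedy-remaining run (x∈p∧x≢y⇒x∈p-y y∈R (y∉σs ∘ Any.here)) (y∉σs ∘ Any.there)

countIn-lessThan-∷ : MaxBelow R t s → y ∈ R → countIn (lessThan y) xs ≡ countIn (lessThan y) ys →
                     countIn (lessThan y) (t ∷ xs) ≡ countIn (lessThan y) (s ∷ ys)
countIn-lessThan-∷ {y = y} max y∈R =
  let s<y⇒t<y , t<y⇒s<y = maxBelow-<-iff max y∈R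
  in  countIn-∷-cong (∈-tabulate⁺ (_<? y) ∘ t<y⇒s<y ∘ ∈-tabulate⁻ (_<? y))
                     (∈-tabulate⁺ (_<? y) ∘ s<y⇒t<y ∘ ∈-tabulate⁻ (_<? y))

greedy-countIn-lessThan : Greedy R ts σs R′ → y ∈ R → y ∉ˡ σs →
                          countIn (lessThan y) ts ≡ countIn (lessThan y) σs
greedy-countIn-lessThan [] _ _ = refl
greedy-countIn-lessThan (max ∷ run) y∈R y∉σs = countIn-lessThan-∷ max y∈R
  (greedy-countIn-lessThan run (x∈p∧x≢y⇒x∈p-y y∈R (y∉σs ∘ Any.here)) (y∉σs ∘ Any.there))

greedy-countIn-lessThan-∷ʳ : Greedy R ts σs R′ → MaxBelow R′ t s → y ∈ R → y ∉ˡ σs →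
                             countIn (lessThan y) (ts ++ [ t ]) ≡ countIn (lessThan y) (σs ++ [ s ])
greedy-countIn-lessThan-∷ʳ {ts = ts} {σs = σs} {t = t} {s = s} {y = y} run max y∈R y∉σs = begin
  countIn L (ts ++ [ t ])         ≡⟨ countIn-++ ts [ t ] ⟩
  countIn L ts + countIn L [ t ]  ≡⟨ cong₂ _+_ (greedy-countIn-lessThan run y∈R y∉σs)
                                               (countIn-lessThan-∷ max (greedy-remaining run y∈R y∉σs) refl) ⟩
  countIn L σs + countIn L [ s ]  ≡⟨ countIn-++ σs [ s ] ⟨
  countIn L (σs ++ [ s ])         ∎
  where
  open ≡-Reasoning
  L = lessThan y

oneLine-unique : ∀ (w : Permutation′ n) → Unique (oneLine w)
oneLine-unique {n} w = Uniqueₚ.map⁺ (Injection.injective (↔⇒↣ w)) (Uniqueₚ.allFin⁺ n)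

take-suc-oneLine : ∀ (w : Permutation′ n) i →
                   take (suc (toℕ i)) (oneLine w) ≡ take (toℕ i) (oneLine w) ++ [ w ⟨$⟩ʳ i ]
take-suc-oneLine w i = begin
  take (suc (toℕ i)) (oneLine w)                    ≡⟨ cong (take (suc (toℕ i))) oneLine≡ ⟩
  take (suc (toℕ i)) (List.tabulate (w ⟨$⟩ʳ_))      ≡⟨ take-suc-tabulate (w ⟨$⟩ʳ_) i ⟩
  take (toℕ i) (List.tabulate (w ⟨$⟩ʳ_)) ++ [ _ ]   ≡⟨ cong (λ l → take (toℕ i) l ++ [ w ⟨$⟩ʳ i ]) oneLine≡ ⟨
  take (toℕ i) (oneLine w) ++ [ w ⟨$⟩ʳ i ]          ∎
  where
  open ≡-Reasoning
  oneLine≡ : oneLine w ≡ List.tabulate (w ⟨$⟩ʳ_)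
  oneLine≡ = map-tabulate id (w ⟨$⟩ʳ_)

oneLine-prefix-unique : ∀ (w : Permutation′ n) i → Unique (take (toℕ i) (oneLine w) ++ [ w ⟨$⟩ʳ i ])
oneLine-prefix-unique w i =
  subst Unique (take-suc-oneLine w i) (Uniqueₚ.take⁺ (suc (toℕ i)) (oneLine-unique w))

oneLine-prefix-hall : ∀ {p} (w : Permutation′ n) i → toℕ i < p → R ≤ˢ fromList (take p (oneLine w)) →
                      Hall R (take (toℕ i) (oneLine w) ++ [ w ⟨$⟩ʳ i ])
oneLine-prefix-hall {R = R} {p = p} w i i<p R≤W = subst (Hall R) (take-suc-oneLine w i)
  (hall-⊑ {R = R} (Sublist.take⁺ i<p) (gale⇒hall (Uniqueₚ.take⁺ p (oneLine-unique w)) R≤W))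

proposition5p2 : ∀ {n : ℕ} (p : ℕ) → 1 ≤ p → p ≤ n →
    (Y : Subset n) → ∣ Y ∣ ≡ p →
    (w : Permutation′ n) →
    Y ≤ˢ fromList (take p (oneLine w)) →
    (i : Fin n) → toℕ i < p →
    ∃₂ λ (σs : List (Fin n)) (σi : Fin n) →
      sigmaSeq Y (take (suc (toℕ i)) (oneLine w)) ≡ just (σs ++ [ σi ]) ×
      (σi ≤ᶠ w ⟨$⟩ʳ i) ×
      ((y : Fin n) → y ∈ Y → y ∉ˡ σs →
        ((σi <ᶠ y → w ⟨$⟩ʳ i <ᶠ y) × (w ⟨$⟩ʳ i <ᶠ y → σi <ᶠ y)) ×
        (∣ fromList (take (suc (toℕ i)) (oneLine w)) ∩ lessThan y ∣
           ≡ ∣ fromList (σs ++ [ σi ]) ∩ lessThan y ∣))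
proposition5p2 p _ _ Y _ w Y≤W i i<p rewrite take-suc-oneLine w i
  with hall⇒greedy (oneLine-prefix-hall w i i<p Y≤W)
... | σ , _ , sigmaSeq≡σ , run with greedy-∷ʳ⁻ {ts = take (toℕ i) (oneLine w)} run
... | σs , σi , R′ , refl , run′ , max@(_ , σi≤wᵢ , _) =
  σs , σi , sigmaSeq≡σ , σi≤wᵢ , λ y y∈Y y∉σs →
    maxBelow-<-iff max (greedy-remaining run′ y∈Y y∉σs) ,
    (begin
      ∣ fromList (take (toℕ i) (oneLine w) ++ [ w ⟨$⟩ʳ i ]) ∩ lessThan y ∣
        ≡⟨ ∣fromList∩q∣≡countIn (oneLine-prefix-unique w i) ⟩
      countIn (lessThan y) (take (toℕ i) (oneLine w) ++ [ w ⟨$⟩ʳ i ])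
        ≡⟨ greedy-countIn-lessThan-∷ʳ run′ max y∈Y y∉σs ⟩
      countIn (lessThan y) (σs ++ [ σi ])
        ≡⟨ ∣fromList∩q∣≡countIn (greedy-unique run) ⟨
      ∣ fromList (σs ++ [ σi ]) ∩ lessThan y ∣
        ∎)
  where open ≡-Reasoning
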